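{- For every integer $n\geq 0$, \[ \sum_{k=0}^{n}(-1)^k x^k q^{k(3k+1)/2}{n\brack k} \frac{(cq^{ -k};q)_k\,(dq^{ -k};q)_k\,(1-xq^{2k+1})}{(cx;q)_{k+1}\,(dx;q)_{k+1}\,(xq^{k+1};q)_{n+1}} =\frac{(cdx;q)_n}{(cx;q)_{n+1}\,(dx;q)_{n+1}}. \]
   Context: For a complex number $a$ and a nonnegative integer $m$, $(a;q)_m=\prod_{j=0}^{m-1}(1-aq^j)$. The $q$-binomial coefficient is ${n\brack k}=\frac{(q;q)_n}{(q;q)_k(q;q)_{n-k}}$ for $0\le k\le n$. Here $q$ is a complex number with $|q|<1$ and $c,d,x$ are such that all denominators are nonzero (equivalently, the identity holds as an identity of rational functions). -}

module Defs where

open import Level using (_⊔_) renaming (suc to lsuc)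
open import Data.Nat using (ℕ; zero; suc; _∸_) renaming (_+_ to _+ℕ_; _*_ to _*ℕ_)
open import Relation.Nullary using (¬_)
open import Algebra.Bundles using (CommutativeRing)

-- A field: a commutative ring with 0 ≠ 1 and a (total) inversion
-- operation which is a genuine inverse on every nonzero element
-- (the value of 0⁻¹ is irrelevant; it is never used under the
-- nonzero hypotheses of the theorem).
record Field (c ℓ : Level.Level) : Set (lsuc (c ⊔ ℓ)) where
  field
    commutativeRing : CommutativeRing c ℓ
  open CommutativeRing commutativeRing public
  infix 8 _⁻¹
  field
    _⁻¹      : Carrier → Carrier
    ⁻¹-cong  : ∀ {a b} → a ≈ b → a ⁻¹ ≈ b ⁻¹
    ⁻¹-inverseʳ : ∀ a → ¬ (a ≈ 0#) → a * a ⁻¹ ≈ 1#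
    0≉1      : ¬ (0# ≈ 1#)

module FieldDefs {c ℓ} (F : Field c ℓ) where
  open Field F

  infixr 8 _^_
  _^_ : Carrier → ℕ → Carrier
  a ^ zero  = 1#
  a ^ suc m = a * (a ^ m)

  infixl 7 _/_
  _/_ : Carrier → Carrier → Carrier
  a / b = a * b ⁻¹

  poch : Carrier → Carrier → ℕ → Carrier
  poch a q zero    = 1#
  poch a q (suc m) = poch a q m * (1# - a * q ^ m)

  qbin : Carrier → ℕ → ℕ → Carrier
  qbin q n k = poch q q n / (poch q q k * poch q q (n ∸ k))

  sumTo : ℕ → (ℕ → Carrier) → Carrier
  sumTo zero    f = f 0
  sumTo (suc n) f = sumTo n f + f (suc n)

-- Both sides f(n) satisfy the first-order recurrence
--   (1 - c x q^(n+1)) (1 - d x q^(n+1)) f(n+1) = (1 - c d x q^n) f(n)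
-- and agree at n = 0. For the right-hand side this is immediate. For the sum it
-- is creative telescoping: writing t(n,k) for its k-th term, a q-Zeilberger
-- certificate expresses q (D t(n+1,k) - E t(n,k)) as G(k) - H(k) with
-- G(k) = H(k+1), G(n+1) = 0 and H(0) = 0, so the corresponding combination of
-- the two sums telescopes to zero.
module Submission where

open import Defs
open import Data.Nat using (ℕ; suc; _≤_) renaming (_+_ to _+ℕ_; _*_ to _*ℕ_; _/_ to _/ℕ_)
open import Relation.Nullary using (¬_)

open import Data.Nat using (zero; _∸_; _<_; z≤n; s≤s)
import Data.Nat.Properties as ℕ
open import Data.Nat.DivMod using (+-distrib-/-∣ʳ; m*n/n≡m)
open import Data.Nat.Divisibility using (divides-refl)
open import Data.Nat.Tactic.RingSolver using (solve-∀)
open import Data.Integer as ℤ using (ℤ; +_; -[1+_]; _⊖_; _◃_; sign; ∣_∣)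
import Data.Integer.Properties as ℤ
open import Data.Sign as Sign using (Sign)
open import Data.Sum using (inj₁; inj₂)
open import Data.Maybe using (Maybe; just; nothing)
open import Relation.Binary.PropositionalEquality as ≡ using (_≡_)
open import Relation.Nullary using (yes; no)
open import Algebra.Bundles using (CommutativeRing)
import Algebra.Solver.Ring.AlmostCommutativeRing as ACR
import Algebra.Solver.Ring as RingSolver

pentagonal : ℕ → ℕ
pentagonal k = (k *ℕ (3 *ℕ k +ℕ 1)) /ℕ 2

pentagonal-suc : ∀ k → pentagonal (suc k) ≡ pentagonal k +ℕ (2 +ℕ 3 *ℕ k)
pentagonal-suc k = begin
  (suc k *ℕ (3 *ℕ suc k +ℕ 1)) /ℕ 2                 ≡⟨ ≡.cong (_/ℕ 2) (expand k) ⟩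
  (k *ℕ (3 *ℕ k +ℕ 1) +ℕ (2 +ℕ 3 *ℕ k) *ℕ 2) /ℕ 2  ≡⟨ +-distrib-/-∣ʳ (k *ℕ (3 *ℕ k +ℕ 1)) (divides-refl (2 +ℕ 3 *ℕ k)) ⟩
  pentagonal k +ℕ (2 +ℕ 3 *ℕ k) *ℕ 2 /ℕ 2          ≡⟨ ≡.cong (pentagonal k +ℕ_) (m*n/n≡m (2 +ℕ 3 *ℕ k) 2) ⟩
  pentagonal k +ℕ (2 +ℕ 3 *ℕ k)                    ∎
  where
  open ≡.≡-Reasoning
  expand : ∀ k → suc k *ℕ (3 *ℕ suc k +ℕ 1) ≡ k *ℕ (3 *ℕ k +ℕ 1) +ℕ (2 +ℕ 3 *ℕ k) *ℕ 2
  expand = solve-∀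

-- The ring solver of the standard library needs a coefficient ring with
-- computable equality; for an abstract commutative ring this is ℤ, mapped
-- in by n ↦ n × 1# (in the variant of _×_ with 1 × a = a, so that the
-- constant 1 denotes 1# definitionally).
module ℤ-CoefficientSolver {c ℓ} (R : CommutativeRing c ℓ) where
  open CommutativeRing R
  open import Algebra.Properties.Semiring.Mult.TCOptimised semiring using (_×_; 1+×; ×-homo-+; ×1-homo-*)
  open import Algebra.Properties.Ring ring using (-1*x≈-x; -0#≈0#)
  open import Algebra.Properties.AbelianGroup +-abelianGroup using (⁻¹-involutive; ⁻¹-∙-comm)
  open import Algebra.Properties.CommutativeSemigroup *-commutativeSemigroup using (interchange)
  open import Relation.Binary.Reasoning.Setoid setoid

  ⟦_⟧ℤ : ℤ → Carrier
  ⟦ + n ⟧ℤ      = n × 1#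
  ⟦ -[1+ n ] ⟧ℤ = - (suc n × 1#)

  ⟦⊖⟧ : ∀ m n → ⟦ m ⊖ n ⟧ℤ ≈ m × 1# - n × 1#
  ⟦⊖⟧ m       zero    = sym (trans (+-congˡ -0#≈0#) (+-identityʳ _))
  ⟦⊖⟧ zero    (suc n) = sym (+-identityˡ _)
  ⟦⊖⟧ (suc m) (suc n) = begin
    ⟦ suc m ⊖ suc n ⟧ℤ            ≡⟨ ≡.cong ⟦_⟧ℤ (ℤ.[1+m]⊖[1+n]≡m⊖n m n) ⟩
    ⟦ m ⊖ n ⟧ℤ                    ≈⟨ ⟦⊖⟧ m n ⟩
    m × 1# - n × 1#               ≈⟨ cancel-1# (m × 1#) (n × 1#) ⟨
    (1# + m × 1#) - (1# + n × 1#) ≈⟨ +-cong (1+× m 1#) (-‿cong (1+× n 1#)) ⟨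
    suc m × 1# - suc n × 1#       ∎
    where
    cancel-1# : ∀ a b → (1# + a) - (1# + b) ≈ a - b
    cancel-1# a b = begin
      (1# + a) + - (1# + b)   ≈⟨ +-cong (+-comm a 1#) (⁻¹-∙-comm 1# b) ⟨
      (a + 1#) + (- 1# + - b) ≈⟨ +-assoc a 1# _ ⟩
      a + (1# + (- 1# + - b)) ≈⟨ +-congˡ (+-assoc 1# (- 1#) (- b)) ⟨
      a + ((1# - 1#) + - b)   ≈⟨ +-congˡ (trans (+-congʳ (-‿inverseʳ 1#)) (+-identityˡ _)) ⟩
      a - b                   ∎

  ⟦_⟧± : Sign → Carrier
  ⟦ Sign.+ ⟧± = 1#
  ⟦ Sign.- ⟧± = - 1#

  ⟦◃⟧ : ∀ s n → ⟦ s ◃ n ⟧ℤ ≈ ⟦ s ⟧± * (n × 1#)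
  ⟦◃⟧ Sign.+ zero    = sym (zeroʳ _)
  ⟦◃⟧ Sign.- zero    = sym (zeroʳ _)
  ⟦◃⟧ Sign.+ (suc n) = sym (*-identityˡ _)
  ⟦◃⟧ Sign.- (suc n) = sym (-1*x≈-x _)

  ⟦sign⟧ : ∀ i → ⟦ i ⟧ℤ ≈ ⟦ sign i ⟧± * (∣ i ∣ × 1#)
  ⟦sign⟧ (+ n)    = sym (*-identityˡ _)
  ⟦sign⟧ -[1+ n ] = sym (-1*x≈-x _)

  ⟦*⟧± : ∀ s t → ⟦ s Sign.* t ⟧± ≈ ⟦ s ⟧± * ⟦ t ⟧±
  ⟦*⟧± Sign.+ t      = sym (*-identityˡ _)
  ⟦*⟧± Sign.- Sign.+ = sym (*-identityʳ _)
  ⟦*⟧± Sign.- Sign.- = trans (sym (⁻¹-involutive 1#)) (sym (-1*x≈-x _))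

  ⟦+⟧ : ∀ i j → ⟦ i ℤ.+ j ⟧ℤ ≈ ⟦ i ⟧ℤ + ⟦ j ⟧ℤ
  ⟦+⟧ (+ m)    (+ n)    = ×-homo-+ 1# m n
  ⟦+⟧ (+ m)    -[1+ n ] = ⟦⊖⟧ m (suc n)
  ⟦+⟧ -[1+ m ] (+ n)    = trans (⟦⊖⟧ n (suc m)) (+-comm _ _)
  ⟦+⟧ -[1+ m ] -[1+ n ] = begin
    - (suc (suc (m +ℕ n)) × 1#)     ≡⟨ ≡.cong (λ k → - (suc k × 1#)) (ℕ.+-suc m n) ⟨
    - ((suc m +ℕ suc n) × 1#)       ≈⟨ -‿cong (×-homo-+ 1# (suc m) (suc n)) ⟩
    - (suc m × 1# + suc n × 1#)     ≈⟨ ⁻¹-∙-comm _ _ ⟨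
    - (suc m × 1#) + - (suc n × 1#) ∎

  ⟦*⟧ : ∀ i j → ⟦ i ℤ.* j ⟧ℤ ≈ ⟦ i ⟧ℤ * ⟦ j ⟧ℤ
  ⟦*⟧ i j = begin
    ⟦ i ℤ.* j ⟧ℤ                                                ≈⟨ ⟦◃⟧ (sign i Sign.* sign j) (∣ i ∣ *ℕ ∣ j ∣) ⟩
    ⟦ sign i Sign.* sign j ⟧± * ((∣ i ∣ *ℕ ∣ j ∣) × 1#)          ≈⟨ *-cong (⟦*⟧± (sign i) (sign j)) (×1-homo-* ∣ i ∣ ∣ j ∣) ⟩
    (⟦ sign i ⟧± * ⟦ sign j ⟧±) * ((∣ i ∣ × 1#) * (∣ j ∣ × 1#)) ≈⟨ interchange _ _ _ _ ⟩
    (⟦ sign i ⟧± * (∣ i ∣ × 1#)) * (⟦ sign j ⟧± * (∣ j ∣ × 1#)) ≈⟨ *-cong (⟦sign⟧ i) (⟦sign⟧ j) ⟨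
    ⟦ i ⟧ℤ * ⟦ j ⟧ℤ                                              ∎

  ⟦-⟧ : ∀ i → ⟦ ℤ.- i ⟧ℤ ≈ - ⟦ i ⟧ℤ
  ⟦-⟧ (+ zero)  = sym -0#≈0#
  ⟦-⟧ (+ suc n) = refl
  ⟦-⟧ -[1+ n ]  = sym (⁻¹-involutive _)

  homomorphism : ACR._-Raw-AlmostCommutative⟶_ ℤ.+-*-rawRing (ACR.fromCommutativeRing R)
  homomorphism = record
    { ⟦_⟧ = ⟦_⟧ℤ ; +-homo = ⟦+⟧ ; *-homo = ⟦*⟧ ; -‿homo = ⟦-⟧
    ; 0-homo = refl ; 1-homo = refl }

  ⟦≟⟧ : ∀ i j → Maybe (⟦ i ⟧ℤ ≈ ⟦ j ⟧ℤ)
  ⟦≟⟧ i j with i ℤ.≟ j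
  ... | yes ≡.refl = just refl
  ... | no _       = nothing

  open RingSolver ℤ.+-*-rawRing (ACR.fromCommutativeRing R) homomorphism ⟦≟⟧ public

  :1 : ∀ {m} → Polynomial m
  :1 = con (+ 1)

module _ {ℓc ℓ} (F : Field ℓc ℓ) where
  open Field F
  open FieldDefs F
  open ℤ-CoefficientSolver commutativeRing using (solve; _:=_; _:+_; _:-_; _:*_; :-_; :1)
  open import Algebra.Properties.AbelianGroup +-abelianGroup using (x∙y⁻¹≈ε⇒x≈y)
  open import Algebra.Properties.Ring ring using (-0#≈0#)
  open import Algebra.Properties.CommutativeSemigroup *-commutativeSemigroup using (interchange)
  open import Relation.Binary.Reasoning.Setoid setoid

  Nonzero : Carrier → Set ℓ
  Nonzero a = ¬ (a ≈ 0#)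

  ⁻¹-inverseˡ : ∀ {a} → Nonzero a → a ⁻¹ * a ≈ 1#
  ⁻¹-inverseˡ {a} a≉0 = trans (*-comm _ _) (⁻¹-inverseʳ a a≉0)

  *-cancelˡ : ∀ {a b b′} → Nonzero a → a * b ≈ a * b′ → b ≈ b′
  *-cancelˡ {a} {b} {b′} a≉0 ab≈ab′ = begin
    b               ≈⟨ *-identityˡ b ⟨
    1# * b          ≈⟨ *-congʳ (⁻¹-inverseˡ a≉0) ⟨
    (a ⁻¹ * a) * b  ≈⟨ *-assoc _ _ _ ⟩
    a ⁻¹ * (a * b)  ≈⟨ *-congˡ ab≈ab′ ⟩
    a ⁻¹ * (a * b′) ≈⟨ *-assoc _ _ _ ⟨
    (a ⁻¹ * a) * b′ ≈⟨ *-congʳ (⁻¹-inverseˡ a≉0) ⟩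
    1# * b′         ≈⟨ *-identityˡ b′ ⟩
    b′              ∎

  *-nonzero : ∀ {a b} → Nonzero a → Nonzero b → Nonzero (a * b)
  *-nonzero {a} a≉0 b≉0 ab≈0 = b≉0 (*-cancelˡ a≉0 (trans ab≈0 (sym (zeroʳ a))))

  nonzero-*ˡ : ∀ {a b} → Nonzero (a * b) → Nonzero a
  nonzero-*ˡ {b = b} ab≉0 a≈0 = ab≉0 (trans (*-congʳ a≈0) (zeroˡ b))

  nonzero-*ʳ : ∀ {a b} → Nonzero (a * b) → Nonzero b
  nonzero-*ʳ {a} ab≉0 b≈0 = ab≉0 (trans (*-congˡ b≈0) (zeroʳ a))

  ⁻¹-distrib-* : ∀ {a b} → Nonzero a → Nonzero b → (a * b) ⁻¹ ≈ a ⁻¹ * b ⁻¹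
  ⁻¹-distrib-* {a} {b} a≉0 b≉0 = *-cancelˡ ab≉0 (begin
    (a * b) * (a * b) ⁻¹    ≈⟨ ⁻¹-inverseʳ _ ab≉0 ⟩
    1#                      ≈⟨ *-identityˡ 1# ⟨
    1# * 1#                 ≈⟨ *-cong (⁻¹-inverseʳ a a≉0) (⁻¹-inverseʳ b b≉0) ⟨
    (a * a ⁻¹) * (b * b ⁻¹) ≈⟨ interchange _ _ _ _ ⟩
    (a * b) * (a ⁻¹ * b ⁻¹) ∎)
    where ab≉0 = *-nonzero a≉0 b≉0

  /-cross : ∀ {a b a′ b′} → Nonzero b → Nonzero b′ → a * b′ ≈ a′ * b → a / b ≈ a′ / b′
  /-cross {a} {b} {a′} {b′} b≉0 b′≉0 ab′≈a′b = begin
    a * b ⁻¹                    ≈⟨ *-identityʳ _ ⟨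
    (a * b ⁻¹) * 1#             ≈⟨ *-congˡ (⁻¹-inverseʳ b′ b′≉0) ⟨
    (a * b ⁻¹) * (b′ * b′ ⁻¹)   ≈⟨ interchange _ _ _ _ ⟩
    (a * b′) * (b ⁻¹ * b′ ⁻¹)   ≈⟨ *-congʳ ab′≈a′b ⟩
    (a′ * b) * (b ⁻¹ * b′ ⁻¹)   ≈⟨ regroup a′ b (b ⁻¹) (b′ ⁻¹) ⟩
    (a′ * b′ ⁻¹) * (b * b ⁻¹)   ≈⟨ *-congˡ (⁻¹-inverseʳ b b≉0) ⟩
    (a′ * b′ ⁻¹) * 1#           ≈⟨ *-identityʳ _ ⟩
    a′ * b′ ⁻¹                  ∎
    where
    regroup : ∀ u v v′ w → (u * v) * (v′ * w) ≈ (u * w) * (v * v′)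
    regroup = solve 4 (λ u v v′ w → u :* v :* (v′ :* w) := u :* w :* (v :* v′)) refl

  x*[1-ay]≈x-a : ∀ {u v} a → u * v ≈ 1# → u * (1# - a * v) ≈ u - a
  x*[1-ay]≈x-a {u} {v} a uv≈1 = begin
    u * (1# - a * v)   ≈⟨ expand u a v ⟩
    u - a * (u * v)    ≈⟨ +-congˡ (-‿cong (*-congˡ uv≈1)) ⟩
    u - a * 1#         ≈⟨ +-congˡ (-‿cong (*-identityʳ a)) ⟩
    u - a              ∎
    where
    expand : ∀ u a v → u * (1# - a * v) ≈ u - a * (u * v)
    expand = solve 3 (λ u a v → u :* (:1 :- a :* v) := u :- a :* (u :* v)) refl

  1-*-cong : ∀ a {t t′} → t ≈ t′ → 1# - a * t ≈ 1# - a * t′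
  1-*-cong a t≈t′ = +-congˡ (-‿cong (*-congˡ t≈t′))

  *-[1-1]≈0 : ∀ a → a * (1# - 1#) ≈ 0#
  *-[1-1]≈0 a = trans (*-congˡ (-‿inverseʳ 1#)) (zeroʳ a)

  /-numerator-zero : ∀ a {b} c → b ≈ 0# → (a * b) / c ≈ 0#
  /-numerator-zero a c b≈0 = trans (*-congʳ (trans (*-congˡ b≈0) (zeroʳ a))) (zeroˡ (c ⁻¹))

  ^-+ : ∀ a m n → a ^ (m +ℕ n) ≈ a ^ m * a ^ n
  ^-+ a zero    n = sym (*-identityˡ _)
  ^-+ a (suc m) n = trans (*-congˡ (^-+ a m n)) (sym (*-assoc _ _ _))

  ^-∸-split : ∀ a {k m} → k ≤ m → a ^ m ≈ a ^ (m ∸ k) * a ^ k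
  ^-∸-split a {k} {m} k≤m =
    trans (reflexive (≡.cong (a ^_) (≡.sym (ℕ.m∸n+n≡m k≤m)))) (^-+ a (m ∸ k) k)

  ^-2* : ∀ a k → a ^ (2 *ℕ k) ≈ a ^ k * a ^ k
  ^-2* a k = trans (^-+ a k (k +ℕ 0)) (*-congˡ (reflexive (≡.cong (a ^_) (ℕ.+-identityʳ k))))

  ^-2*+1 : ∀ a k → a ^ (2 *ℕ k +ℕ 1) ≈ a * (a ^ k * a ^ k)
  ^-2*+1 a k = trans (reflexive (≡.cong (a ^_) (ℕ.+-comm (2 *ℕ k) 1))) (*-congˡ (^-2* a k))

  ^-3* : ∀ a k → a ^ (3 *ℕ k) ≈ a ^ k * (a ^ k * a ^ k)
  ^-3* a k = trans (^-+ a k (2 *ℕ k)) (*-congˡ (^-2* a k))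

  ^-inverse : ∀ {a} → Nonzero a → ∀ k → a ^ k * (a ⁻¹) ^ k ≈ 1#
  ^-inverse a≉0 zero    = *-identityˡ 1#
  ^-inverse {a} a≉0 (suc k) = begin
    (a * a ^ k) * (a ⁻¹ * (a ⁻¹) ^ k)   ≈⟨ interchange _ _ _ _ ⟩
    (a * a ⁻¹) * (a ^ k * (a ⁻¹) ^ k)   ≈⟨ *-cong (⁻¹-inverseʳ a a≉0) (^-inverse a≉0 k) ⟩
    1# * 1#                             ≈⟨ *-identityˡ 1# ⟩
    1#                                  ∎

  poch-cong : ∀ {a b} r m → a ≈ b → poch a r m ≈ poch b r m
  poch-cong r zero    a≈b = refl
  poch-cong r (suc m) a≈b = *-cong (poch-cong r m a≈b) (+-congˡ (-‿cong (*-congʳ a≈b)))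

  poch-unfoldˡ : ∀ a r m → poch a r (suc m) ≈ (1# - a) * poch (a * r) r m
  poch-unfoldˡ a r zero    = solve 1 (λ a → :1 :* (:1 :- a :* :1) := (:1 :- a) :* :1) refl a
  poch-unfoldˡ a r (suc m) = trans (*-congʳ (poch-unfoldˡ a r m)) (regroup a r (r ^ m) (poch (a * r) r m))
    where
    regroup : ∀ a r s p → (1# - a) * p * (1# - a * (r * s)) ≈ (1# - a) * (p * (1# - a * r * s))
    regroup = solve 4 (λ a r s p → (:1 :- a) :* p :* (:1 :- a :* (r :* s)) := (:1 :- a) :* (p :* (:1 :- a :* r :* s))) refl

  poch-nonzero-≤ : ∀ {a r k m} → Nonzero (poch a r m) → k ≤ m → Nonzero (poch a r k)
  poch-nonzero-≤ {m = zero}  p≉0 z≤n = p≉0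
  poch-nonzero-≤ {m = suc m} p≉0 k≤ with ℕ.m≤n⇒m<n∨m≡n k≤
  ... | inj₁ (s≤s k≤m) = poch-nonzero-≤ (nonzero-*ˡ p≉0) k≤m
  ... | inj₂ ≡.refl    = p≉0

  sumTo-cong : ∀ m {f g : ℕ → Carrier} → (∀ k → k ≤ m → f k ≈ g k) → sumTo m f ≈ sumTo m g
  sumTo-cong zero    f≈g = f≈g 0 z≤n
  sumTo-cong (suc m) f≈g = +-cong (sumTo-cong m (λ k k≤m → f≈g k (ℕ.m≤n⇒m≤1+n k≤m))) (f≈g (suc m) ℕ.≤-refl)

  sumTo-linear : ∀ m a b (f g : ℕ → Carrier) →
    sumTo m (λ k → a * f k - b * g k) ≈ a * sumTo m f - b * sumTo m g
  sumTo-linear zero    a b f g = refl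
  sumTo-linear (suc m) a b f g =
    trans (+-congʳ (sumTo-linear m a b f g)) (collect a b (sumTo m f) (f (suc m)) (sumTo m g) (g (suc m)))
    where
    collect : ∀ a b s y t z → (a * s - b * t) + (a * y - b * z) ≈ a * (s + y) - b * (t + z)
    collect = solve 6 (λ a b s y t z → a :* s :- b :* t :+ (a :* y :- b :* z) := a :* (s :+ y) :- b :* (t :+ z)) refl

  sumTo-telescope : ∀ m (g h : ℕ → Carrier) → (∀ k → k < m → g k ≈ h (suc k)) →
    sumTo m (λ k → g k - h k) ≈ g m - h 0
  sumTo-telescope zero    g h shift = refl
  sumTo-telescope (suc m) g h shift = begin
    sumTo m (λ k → g k - h k) + (g (suc m) - h (suc m)) ≈⟨ +-congʳ (sumTo-telescope m g h (λ k k<m → shift k (ℕ.m<n⇒m<1+n k<m))) ⟩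
    (g m - h 0) + (g (suc m) - h (suc m))              ≈⟨ +-congʳ (+-congʳ (shift m (ℕ.n<1+n m))) ⟩
    (h (suc m) - h 0) + (g (suc m) - h (suc m))        ≈⟨ cancel (h (suc m)) (h 0) (g (suc m)) ⟩
    g (suc m) - h 0                                    ∎
    where
    cancel : ∀ u v w → (u - v) + (w - u) ≈ w - v
    cancel = solve 3 (λ u v w → u :- v :+ (w :- u) := w :- v) refl

  module Summation (q c d x : Carrier) (q≉0 : Nonzero q) where

    α : ℕ → Carrier
    α k = (- 1#) ^ k * x ^ k * q ^ pentagonal k

    numerator : ℕ → Carrier
    numerator k = poch (c * (q ⁻¹) ^ k) q k * poch (d * (q ⁻¹) ^ k) q k * (1# - x * q ^ (2 *ℕ k +ℕ 1))

    denominator : ℕ → ℕ → Carrier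
    denominator m k = poch (c * x) q (suc k) * poch (d * x) q (suc k) * poch (x * q ^ suc k) q (suc m)

    term : ℕ → ℕ → Carrier
    term m k = α k * qbin q m k * (numerator k / denominator m k)

    S : ℕ → Carrier
    S m = sumTo m (term m)

    R : ℕ → Carrier
    R m = poch (c * d * x) q m / (poch (c * x) q (suc m) * poch (d * x) q (suc m))

    commonDenominator : ℕ → ℕ → Carrier
    commonDenominator m k = poch q q k * poch q q (m ∸ k) * denominator m k

    record Regular (m : ℕ) : Set ℓ where
      field
        qq≉0 : Nonzero (poch q q m)
        cx≉0 : Nonzero (poch (c * x) q (suc m))
        dx≉0 : Nonzero (poch (d * x) q (suc m))
        xq≉0 : ∀ k → k ≤ m → Nonzero (poch (x * q ^ suc k) q (suc m))

    Regular-pred : ∀ {m} → Regular (suc m) → Regular m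
    Regular-pred reg = record
      { qq≉0 = nonzero-*ˡ qq≉0
      ; cx≉0 = nonzero-*ˡ cx≉0
      ; dx≉0 = nonzero-*ˡ dx≉0
      ; xq≉0 = λ k k≤m → nonzero-*ˡ (xq≉0 k (ℕ.m≤n⇒m≤1+n k≤m))
      }
      where open Regular reg

    module _ {m k} (reg : Regular m) (k≤m : k ≤ m) where
      open Regular reg

      qbinDenominator-nonzero : Nonzero (poch q q k * poch q q (m ∸ k))
      qbinDenominator-nonzero = *-nonzero (poch-nonzero-≤ qq≉0 k≤m) (poch-nonzero-≤ qq≉0 (ℕ.m∸n≤m m k))

      denominator-nonzero : Nonzero (denominator m k)
      denominator-nonzero =
        *-nonzero (*-nonzero (poch-nonzero-≤ cx≉0 (s≤s k≤m)) (poch-nonzero-≤ dx≉0 (s≤s k≤m))) (xq≉0 k k≤m)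

      commonDenominator-nonzero : Nonzero (commonDenominator m k)
      commonDenominator-nonzero = *-nonzero qbinDenominator-nonzero denominator-nonzero

      term-as-fraction : term m k ≈ (α k * poch q q m * numerator k) / commonDenominator m k
      term-as-fraction = begin
        α k * (P * B ⁻¹) * (numerator k * D ⁻¹)   ≈⟨ regroup (α k) P (B ⁻¹) (numerator k) (D ⁻¹) ⟩
        (α k * P * numerator k) * (B ⁻¹ * D ⁻¹)   ≈⟨ *-congˡ (⁻¹-distrib-* qbinDenominator-nonzero denominator-nonzero) ⟨
        (α k * P * numerator k) * (B * D) ⁻¹      ∎
        where
        P = poch q q m
        B = poch q q k * poch q q (m ∸ k)
        D = denominator m k
        regroup : ∀ a p b n e → a * (p * b) * (n * e) ≈ (a * p * n) * (b * e)
        regroup = solve 5 (λ a p b n e → a :* (p :* b) :* (n :* e) := a :* p :* n :* (b :* e)) refl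

    R-denominator-nonzero : ∀ {m} → Regular m → Nonzero (poch (c * x) q (suc m) * poch (d * x) q (suc m))
    R-denominator-nonzero reg = *-nonzero cx≉0 dx≉0 where open Regular reg

    S≈R-zero : Regular 0 → S 0 ≈ R 0
    S≈R-zero reg = trans (term-as-fraction reg z≤n)
      (/-cross (commonDenominator-nonzero reg z≤n) (R-denominator-nonzero reg)
        (clear x q (poch (c * x) q 1) (poch (d * x) q 1)))
      where
      clear : ∀ x q a b → (1# * 1# * 1# * 1# * (1# * 1# * (1# - x * (q * 1#)))) * (a * b)
                          ≈ 1# * (1# * 1# * (a * b * (1# * (1# - x * (q * 1#) * 1#))))
      clear = solve 4 (λ x q a b → :1 :* :1 :* :1 :* :1 :* (:1 :* :1 :* (:1 :- x :* (q :* :1))) :* (a :* b)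
                                   := :1 :* (:1 :* :1 :* (a :* b :* (:1 :* (:1 :- x :* (q :* :1) :* :1))))) refl

    -- WZ certificate, with Q standing for q^k and M for q^(n+1-k); found by
    -- the q-Zeilberger algorithm.
    upper : Carrier → Carrier → Carrier
    upper Q M = x * M * Q * (q * Q - c) * (q * Q - d) * (1# - x * (q * Q)) * (1# - M)

    lower : Carrier → Carrier → Carrier
    lower Q M = - (q * M * (1# - c * x * Q) * (1# - d * x * Q) * (1# - x * q * M * Q * Q) * (1# - Q))

    wz-certificate : ∀ Q M →
      q * ((1# - c * x * (M * Q)) * (1# - d * x * (M * Q))) * ((1# - M * Q) * (1# - x * (q * (Q * Q))))
        - (q - c * d * x * (M * Q)) * ((1# - x * (q * (Q * Q))) * (1# - x * (q * Q) * (M * Q)) * (1# - M))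
      ≈ upper Q M - lower Q M
    wz-certificate = solve 6 (λ q c d x Q M →
        q :* ((:1 :- c :* x :* (M :* Q)) :* (:1 :- d :* x :* (M :* Q))) :* ((:1 :- M :* Q) :* (:1 :- x :* (q :* (Q :* Q))))
          :- (q :- c :* d :* x :* (M :* Q)) :* ((:1 :- x :* (q :* (Q :* Q))) :* (:1 :- x :* (q :* Q) :* (M :* Q)) :* (:1 :- M))
        := x :* M :* Q :* (q :* Q :- c) :* (q :* Q :- d) :* (:1 :- x :* (q :* Q)) :* (:1 :- M)
          :- :- (q :* M :* (:1 :- c :* x :* Q) :* (:1 :- d :* x :* Q) :* (:1 :- x :* q :* M :* Q :* Q) :* (:1 :- Q)))
      refl q c d x

    module Step (n : ℕ) (reg : Regular (suc n)) where
      open Regular reg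

      N : ℕ
      N = suc n

      μ : ℕ → Carrier
      μ k = q ^ (N ∸ k)

      A : ℕ → Carrier
      A k = α k * poch q q n * poch (c * (q ⁻¹) ^ k) q k * poch (d * (q ⁻¹) ^ k) q k

      W : ℕ → Carrier
      W = commonDenominator N

      Dₙ Eₙ : Carrier
      Dₙ = (1# - c * x * q ^ N) * (1# - d * x * q ^ N)
      Eₙ = 1# - c * d * x * q ^ n

      ρ₁ ρ₀ : ℕ → Carrier
      ρ₁ k = (1# - q ^ N) * (1# - x * q ^ (2 *ℕ k +ℕ 1))
      ρ₀ k = (1# - x * q ^ (2 *ℕ k +ℕ 1)) * (1# - x * q ^ suc k * q ^ N) * (1# - μ k)

      t₀ G H : ℕ → Carrier
      t₀ k = (A k * ρ₀ k) / W k
      G k = (A k * upper (q ^ k) (μ k)) / W k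
      H k = (A k * lower (q ^ k) (μ k)) / W k

      W-nonzero : ∀ {k} → k ≤ N → Nonzero (W k)
      W-nonzero = commonDenominator-nonzero reg

      N∸k≡suc[n∸k] : ∀ {k} → k ≤ n → N ∸ k ≡ suc (n ∸ k)
      N∸k≡suc[n∸k] = ℕ.+-∸-assoc 1

      μ-unfold : ∀ {k} → k ≤ n → μ k ≡ q * q ^ (n ∸ k)
      μ-unfold k≤n = ≡.cong (q ^_) (N∸k≡suc[n∸k] k≤n)

      μ-last : 1# - μ N ≈ 0#
      μ-last = trans (+-congˡ (-‿cong (reflexive (≡.cong (q ^_) (ℕ.n∸n≡0 n))))) (-‿inverseʳ 1#)

      term-N : ∀ {k} → k ≤ N → term N k ≈ (A k * ρ₁ k) / W k
      term-N {k} k≤N = trans (term-as-fraction reg k≤N)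
        (*-congʳ (regroup (α k) (poch q q n) (q ^ n) (poch (c * (q ⁻¹) ^ k) q k) (poch (d * (q ⁻¹) ^ k) q k)
                          (q ^ (2 *ℕ k +ℕ 1)) q x))
        where
        regroup : ∀ a p r u v s q x → a * (p * (1# - q * r)) * (u * v * (1# - x * s))
                                        ≈ a * p * u * v * ((1# - q * r) * (1# - x * s))
        regroup = solve 8 (λ a p r u v s q x → a :* (p :* (:1 :- q :* r)) :* (u :* v :* (:1 :- x :* s))
                                                := a :* p :* u :* v :* ((:1 :- q :* r) :* (:1 :- x :* s))) refl

      term-n : ∀ {k} → k ≤ n → term n k ≈ t₀ k
      term-n {k} k≤n = trans (term-as-fraction (Regular-pred reg) k≤n)
        (/-cross (commonDenominator-nonzero (Regular-pred reg) k≤n) (W-nonzero (ℕ.m≤n⇒m≤1+n k≤n)) (begin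
          (α k * poch q q n * numerator k) * W k
            ≡⟨ ≡.cong (λ j → (α k * poch q q n * numerator k) * (poch q q k * poch q q j * denominator N k))
                      (N∸k≡suc[n∸k] k≤n) ⟩
          (α k * P * (Pc * Pd * (1# - x * s))) * (Pk * (P′ * (1# - q * r)) * (Dc * Dd * (Z * (1# - u * t))))
            ≈⟨ regroup (α k) P Pc Pd x s Pk P′ (q * r) Dc Dd Z u t ⟩
          (A k * ((1# - x * s) * (1# - u * t) * (1# - q * r))) * commonDenominator n k
            ≡⟨ ≡.cong (λ M → (A k * ((1# - x * s) * (1# - u * t) * (1# - M))) * commonDenominator n k) (μ-unfold k≤n) ⟨
          (A k * ρ₀ k) * commonDenominator n k ∎))
        where
        P = poch q q n
        Pc = poch (c * (q ⁻¹) ^ k) q k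
        Pd = poch (d * (q ⁻¹) ^ k) q k
        s = q ^ (2 *ℕ k +ℕ 1)
        Pk = poch q q k
        P′ = poch q q (n ∸ k)
        r = q ^ (n ∸ k)
        Dc = poch (c * x) q (suc k)
        Dd = poch (d * x) q (suc k)
        Z = poch (x * q ^ suc k) q N
        u = x * q ^ suc k
        t = q ^ N
        regroup : ∀ a p pc pd x s pk p′ m dc dd z u t →
          (a * p * (pc * pd * (1# - x * s))) * (pk * (p′ * (1# - m)) * (dc * dd * (z * (1# - u * t))))
            ≈ (a * p * pc * pd * ((1# - x * s) * (1# - u * t) * (1# - m))) * (pk * p′ * (dc * dd * z))
        regroup = solve 14 (λ a p pc pd x s pk p′ m dc dd z u t →
            a :* p :* (pc :* pd :* (:1 :- x :* s)) :* (pk :* (p′ :* (:1 :- m)) :* (dc :* dd :* (z :* (:1 :- u :* t))))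
              := a :* p :* pc :* pd :* ((:1 :- x :* s) :* (:1 :- u :* t) :* (:1 :- m)) :* (pk :* p′ :* (dc :* dd :* z)))
          refl

      certificate : ∀ {k} → k ≤ N → q * Dₙ * ρ₁ k - q * Eₙ * ρ₀ k ≈ upper (q ^ k) (μ k) - lower (q ^ k) (μ k)
      certificate {k} k≤N = begin
        q * Dₙ * ρ₁ k - q * Eₙ * ρ₀ k            ≈⟨ +-congˡ (-‿cong (*-congʳ (q*Eₙ q c d x (q ^ n)))) ⟩
        lhs (q ^ N) (q ^ (2 *ℕ k +ℕ 1))          ≈⟨ lhs-cong (^-∸-split q k≤N) (^-2*+1 q k) ⟩
        lhs (μ k * q ^ k) (q * (q ^ k * q ^ k))  ≈⟨ wz-certificate (q ^ k) (μ k) ⟩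
        upper (q ^ k) (μ k) - lower (q ^ k) (μ k) ∎
        where
        q*Eₙ : ∀ q c d x r → q * (1# - c * d * x * r) ≈ q - c * d * x * (q * r)
        q*Eₙ = solve 5 (λ q c d x r → q :* (:1 :- c :* d :* x :* r) := q :- c :* d :* x :* (q :* r)) refl
        lhs : Carrier → Carrier → Carrier
        lhs t s = q * ((1# - c * x * t) * (1# - d * x * t)) * ((1# - t) * (1# - x * s))
                  - (q - c * d * x * t) * ((1# - x * s) * (1# - x * q ^ suc k * t) * (1# - μ k))
        lhs-cong : ∀ {t t′ s s′} → t ≈ t′ → s ≈ s′ → lhs t s ≈ lhs t′ s′
        lhs-cong t≈t′ s≈s′ = +-cong
          (*-cong (*-congˡ (*-cong (1-*-cong (c * x) t≈t′) (1-*-cong (d * x) t≈t′)))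
                  (*-cong (+-congˡ (-‿cong t≈t′)) (1-*-cong x s≈s′)))
          (-‿cong (*-cong (+-congˡ (-‿cong (*-congˡ t≈t′)))
                          (*-congʳ (*-cong (1-*-cong x s≈s′) (1-*-cong (x * q ^ suc k) t≈t′)))))

      wz-equation : ∀ {k} → k ≤ N → (q * Dₙ) * term N k - (q * Eₙ) * t₀ k ≈ G k - H k
      wz-equation {k} k≤N = begin
        (q * Dₙ) * term N k - (q * Eₙ) * t₀ k
          ≈⟨ +-congʳ (*-congˡ (term-N k≤N)) ⟩
        (q * Dₙ) * ((A k * ρ₁ k) / W k) - (q * Eₙ) * t₀ k
          ≈⟨ factor q Dₙ Eₙ (A k) (ρ₁ k) (ρ₀ k) (W k ⁻¹) ⟩
        (A k * (q * Dₙ * ρ₁ k - q * Eₙ * ρ₀ k)) / W k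
          ≈⟨ *-congʳ (*-congˡ (certificate k≤N)) ⟩
        (A k * (upper (q ^ k) (μ k) - lower (q ^ k) (μ k))) / W k
          ≈⟨ expand (A k) (upper (q ^ k) (μ k)) (lower (q ^ k) (μ k)) (W k ⁻¹) ⟩
        G k - H k ∎
        where
        factor : ∀ q d e a r₁ r₀ w → (q * d) * ((a * r₁) * w) - (q * e) * ((a * r₀) * w)
                                       ≈ (a * (q * d * r₁ - q * e * r₀)) * w
        factor = solve 7 (λ q d e a r₁ r₀ w → q :* d :* (a :* r₁ :* w) :- q :* e :* (a :* r₀ :* w)
                                               := a :* (q :* d :* r₁ :- q :* e :* r₀) :* w) refl
        expand : ∀ a u v w → (a * (u - v)) * w ≈ (a * u) * w - (a * v) * w
        expand = solve 4 (λ a u v w → a :* (u :- v) :* w := a :* u :* w :- a :* v :* w) refl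

      A-suc : ∀ k → A (suc k) ≈ - (x * q ^ k) * (q * q ^ k - c) * (q * q ^ k - d) * A k
      A-suc k = begin
        A (suc k)
          ≈⟨ *-cong (*-cong (*-congʳ (*-congˡ α-suc)) (poch-suc c)) (poch-suc d) ⟩
        - 1# * σ * (x * X) * (E * (q * (q * (Q * (Q * Q))))) * P * ((1# - c * w) * Pc) * ((1# - d * w) * Pd)
          ≈⟨ regroup σ X E P Pc Pd x q Q c d w ⟩
        - (x * Q) * ((q * Q) * (1# - c * w)) * ((q * Q) * (1# - d * w)) * A k
          ≈⟨ *-congʳ (*-cong (*-congˡ (x*[1-ay]≈x-a c qw≈1)) (x*[1-ay]≈x-a d qw≈1)) ⟩
        - (x * Q) * (q * Q - c) * (q * Q - d) * A k ∎
        where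
        σ = (- 1#) ^ k
        X = x ^ k
        E = q ^ pentagonal k
        Q = q ^ k
        P = poch q q n
        Pc = poch (c * (q ⁻¹) ^ k) q k
        Pd = poch (d * (q ⁻¹) ^ k) q k
        w = (q ⁻¹) ^ suc k

        qw≈1 : (q * Q) * w ≈ 1#
        qw≈1 = ^-inverse q≉0 (suc k)

        α-suc : q ^ pentagonal (suc k) ≈ E * (q * (q * (Q * (Q * Q))))
        α-suc = trans (reflexive (≡.cong (q ^_) (pentagonal-suc k)))
                      (trans (^-+ q (pentagonal k) (2 +ℕ 3 *ℕ k)) (*-congˡ (*-congˡ (*-congˡ (^-3* q k)))))

        poch-suc : ∀ a → poch (a * w) q (suc k) ≈ (1# - a * w) * poch (a * (q ⁻¹) ^ k) q k
        poch-suc a = trans (poch-unfoldˡ (a * w) q k) (*-congˡ (poch-cong q k (begin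
          a * (q ⁻¹ * (q ⁻¹) ^ k) * q   ≈⟨ solve 4 (λ a v V q → a :* (v :* V) :* q := a :* V :* (q :* v)) refl a (q ⁻¹) ((q ⁻¹) ^ k) q ⟩
          a * (q ⁻¹) ^ k * (q * q ⁻¹)   ≈⟨ *-congˡ (⁻¹-inverseʳ q q≉0) ⟩
          a * (q ⁻¹) ^ k * 1#           ≈⟨ *-identityʳ _ ⟩
          a * (q ⁻¹) ^ k                ∎)))

        regroup : ∀ σ X E P Pc Pd x q Q c d w →
          - 1# * σ * (x * X) * (E * (q * (q * (Q * (Q * Q))))) * P * ((1# - c * w) * Pc) * ((1# - d * w) * Pd)
            ≈ - (x * Q) * ((q * Q) * (1# - c * w)) * ((q * Q) * (1# - d * w)) * (σ * X * E * P * Pc * Pd)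
        regroup = solve 12 (λ σ X E P Pc Pd x q Q c d w →
            :- :1 :* σ :* (x :* X) :* (E :* (q :* (q :* (Q :* (Q :* Q))))) :* P :* ((:1 :- c :* w) :* Pc) :* ((:1 :- d :* w) :* Pd)
              := :- (x :* Q) :* (q :* Q :* (:1 :- c :* w)) :* (q :* Q :* (:1 :- d :* w)) :* (σ :* X :* E :* P :* Pc :* Pd))
          refl

      W-suc : ∀ {k} → k ≤ n →
        W (suc k) * (1# - q * q ^ (n ∸ k)) * (1# - x * (q * q ^ k))
          ≈ W k * ((1# - q * q ^ k) * (1# - c * x * (q * q ^ k)) * (1# - d * x * (q * q ^ k))
                   * (1# - x * (q * (q * q ^ k)) * (q ^ (n ∸ k) * (q * q ^ k))))
      W-suc {k} k≤n = begin
        W (suc k) * (1# - q * r) * (1# - x * (q * Q))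
          ≈⟨ regroup Pk P′ Pc Pd Z q Q c d x r t ⟩
        Pk * (P′ * (1# - q * r)) * (Pc * Pd * ((1# - x * (q * Q)) * Z)) * Y t
          ≈⟨ *-cong W-unfold (*-congˡ (1-*-cong (x * (q * (q * Q))) (^-∸-split q (s≤s k≤n)))) ⟩
        W k * Y (r * (q * Q)) ∎
        where
        Q = q ^ k
        r = q ^ (n ∸ k)
        t = q ^ N
        Pk = poch q q k
        P′ = poch q q (n ∸ k)
        Pc = poch (c * x) q (suc k)
        Pd = poch (d * x) q (suc k)
        Z = poch (x * q ^ suc (suc k)) q N

        Y : Carrier → Carrier
        Y t = (1# - q * Q) * (1# - c * x * (q * Q)) * (1# - d * x * (q * Q)) * (1# - x * (q * (q * Q)) * t)

        W-unfold : Pk * (P′ * (1# - q * r)) * (Pc * Pd * ((1# - x * (q * Q)) * Z)) ≈ W k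
        W-unfold = begin
          Pk * (P′ * (1# - q * r)) * (Pc * Pd * ((1# - x * (q * Q)) * Z))
            ≈⟨ *-congˡ (*-congˡ Z-unfold) ⟨
          Pk * (P′ * (1# - q * r)) * (Pc * Pd * poch (x * (q * Q)) q (suc N))
            ≡⟨ ≡.cong (λ j → Pk * poch q q j * denominator N k) (N∸k≡suc[n∸k] k≤n) ⟨
          W k ∎

          where
          Z-unfold : poch (x * (q * Q)) q (suc N) ≈ (1# - x * (q * Q)) * Z
          Z-unfold = trans (poch-unfoldˡ (x * (q * Q)) q N)
                           (*-congˡ (poch-cong q N (trans (*-assoc x (q * Q) q) (*-congˡ (*-comm (q * Q) q)))))

        regroup : ∀ pk p′ pc pd z q Q c d x r t →
          (pk * (1# - q * Q) * p′ * (pc * (1# - c * x * (q * Q)) * (pd * (1# - d * x * (q * Q))) * (z * (1# - x * (q * (q * Q)) * t))))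
            * (1# - q * r) * (1# - x * (q * Q))
          ≈ pk * (p′ * (1# - q * r)) * (pc * pd * ((1# - x * (q * Q)) * z))
            * ((1# - q * Q) * (1# - c * x * (q * Q)) * (1# - d * x * (q * Q)) * (1# - x * (q * (q * Q)) * t))
        regroup = solve 12 (λ pk p′ pc pd z q Q c d x r t →
            pk :* (:1 :- q :* Q) :* p′ :* (pc :* (:1 :- c :* x :* (q :* Q)) :* (pd :* (:1 :- d :* x :* (q :* Q))) :* (z :* (:1 :- x :* (q :* (q :* Q)) :* t)))
              :* (:1 :- q :* r) :* (:1 :- x :* (q :* Q))
            := pk :* (p′ :* (:1 :- q :* r)) :* (pc :* pd :* ((:1 :- x :* (q :* Q)) :* z))
              :* ((:1 :- q :* Q) :* (:1 :- c :* x :* (q :* Q)) :* (:1 :- d :* x :* (q :* Q)) :* (:1 :- x :* (q :* (q :* Q)) :* t)))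
          refl

      G≈H-suc : ∀ {k} → k ≤ n → G k ≈ H (suc k)
      G≈H-suc {k} k≤n = /-cross (W-nonzero (ℕ.m≤n⇒m≤1+n k≤n)) (W-nonzero (s≤s k≤n)) (begin
        (A k * upper Q (μ k)) * W (suc k)
          ≡⟨ ≡.cong (λ M → (A k * upper Q M) * W (suc k)) (μ-unfold k≤n) ⟩
        (A k * upper Q (q * r)) * W (suc k)
          ≈⟨ expose (A k) x q r Q c d (W (suc k)) ⟩
        (A k * (x * (q * r) * Q * (q * Q - c) * (q * Q - d))) * (W (suc k) * (1# - q * r) * (1# - x * (q * Q)))
          ≈⟨ *-congˡ (W-suc k≤n) ⟩
        (A k * (x * (q * r) * Q * (q * Q - c) * (q * Q - d)))
          * (W k * ((1# - q * Q) * (1# - c * x * (q * Q)) * (1# - d * x * (q * Q)) * (1# - x * (q * (q * Q)) * (r * (q * Q)))))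
          ≈⟨ match (A k) x q r Q c d (W k) ⟩
        (- (x * Q) * (q * Q - c) * (q * Q - d) * A k * lower (q * Q) r) * W k
          ≈⟨ *-congʳ (*-congʳ (A-suc k)) ⟨
        (A (suc k) * lower (q * Q) r) * W k ∎)
        where
        Q = q ^ k
        r = q ^ (n ∸ k)
        expose : ∀ a x q r Q c d w →
          (a * (x * (q * r) * Q * (q * Q - c) * (q * Q - d) * (1# - x * (q * Q)) * (1# - q * r))) * w
            ≈ (a * (x * (q * r) * Q * (q * Q - c) * (q * Q - d))) * (w * (1# - q * r) * (1# - x * (q * Q)))
        expose = solve 8 (λ a x q r Q c d w →
            a :* (x :* (q :* r) :* Q :* (q :* Q :- c) :* (q :* Q :- d) :* (:1 :- x :* (q :* Q)) :* (:1 :- q :* r)) :* w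
              := a :* (x :* (q :* r) :* Q :* (q :* Q :- c) :* (q :* Q :- d)) :* (w :* (:1 :- q :* r) :* (:1 :- x :* (q :* Q))))
          refl
        match : ∀ a x q r Q c d w →
          (a * (x * (q * r) * Q * (q * Q - c) * (q * Q - d)))
            * (w * ((1# - q * Q) * (1# - c * x * (q * Q)) * (1# - d * x * (q * Q)) * (1# - x * (q * (q * Q)) * (r * (q * Q)))))
          ≈ (- (x * Q) * (q * Q - c) * (q * Q - d) * a
              * - (q * r * (1# - c * x * (q * Q)) * (1# - d * x * (q * Q)) * (1# - x * q * r * (q * Q) * (q * Q)) * (1# - q * Q))) * w
        match = solve 8 (λ a x q r Q c d w →
            a :* (x :* (q :* r) :* Q :* (q :* Q :- c) :* (q :* Q :- d))
              :* (w :* ((:1 :- q :* Q) :* (:1 :- c :* x :* (q :* Q)) :* (:1 :- d :* x :* (q :* Q)) :* (:1 :- x :* (q :* (q :* Q)) :* (r :* (q :* Q)))))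
            := :- (x :* Q) :* (q :* Q :- c) :* (q :* Q :- d) :* a
              :* :- (q :* r :* (:1 :- c :* x :* (q :* Q)) :* (:1 :- d :* x :* (q :* Q)) :* (:1 :- x :* q :* r :* (q :* Q) :* (q :* Q)) :* (:1 :- q :* Q)) :* w)
          refl

      G-last : G N ≈ 0#
      G-last = /-numerator-zero (A N) (W N) (trans (*-congˡ μ-last) (zeroʳ _))

      H-zero : H 0 ≈ 0#
      H-zero = /-numerator-zero (A 0) (W 0) (trans (-‿cong (*-[1-1]≈0 _)) -0#≈0#)

      S-via-t₀ : S n ≈ sumTo N t₀
      S-via-t₀ = begin
        sumTo n (term n)    ≈⟨ sumTo-cong n (λ k → term-n) ⟩
        sumTo n t₀          ≈⟨ +-identityʳ _ ⟨
        sumTo n t₀ + 0#     ≈⟨ +-congˡ t₀-last ⟨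
        sumTo N t₀          ∎
        where
        t₀-last : t₀ N ≈ 0#
        t₀-last = /-numerator-zero (A N) (W N) (trans (*-congˡ μ-last) (zeroʳ _))

      S-recurrence : Dₙ * S N ≈ Eₙ * S n
      S-recurrence = *-cancelˡ q≉0 (begin
        q * (Dₙ * S N)  ≈⟨ *-assoc q Dₙ (S N) ⟨
        q * Dₙ * S N    ≈⟨ x∙y⁻¹≈ε⇒x≈y _ _ telescoped ⟩
        q * Eₙ * S n    ≈⟨ *-assoc q Eₙ (S n) ⟩
        q * (Eₙ * S n)  ∎)
        where
        telescoped : q * Dₙ * S N - q * Eₙ * S n ≈ 0#
        telescoped = begin
          q * Dₙ * S N - q * Eₙ * S n                           ≈⟨ +-congˡ (-‿cong (*-congˡ S-via-t₀)) ⟩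
          q * Dₙ * sumTo N (term N) - q * Eₙ * sumTo N t₀       ≈⟨ sumTo-linear N (q * Dₙ) (q * Eₙ) (term N) t₀ ⟨
          sumTo N (λ k → q * Dₙ * term N k - q * Eₙ * t₀ k)    ≈⟨ sumTo-cong N (λ k → wz-equation) ⟩
          sumTo N (λ k → G k - H k)                            ≈⟨ sumTo-telescope N G H (λ k k<N → G≈H-suc (ℕ.≤-pred k<N)) ⟩
          G N - H 0                                            ≈⟨ +-cong G-last (-‿cong H-zero) ⟩
          0# - 0#                                              ≈⟨ -‿inverseʳ 0# ⟩
          0#                                                   ∎

      R-recurrence : Dₙ * R N ≈ Eₙ * R n
      R-recurrence = begin
        Dₙ * (poch (c * d * x) q N * Den N ⁻¹)   ≈⟨ *-assoc _ _ _ ⟨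
        (Dₙ * poch (c * d * x) q N) / Den N     ≈⟨ /-cross (R-denominator-nonzero reg) (R-denominator-nonzero (Regular-pred reg)) cleared ⟩
        (Eₙ * poch (c * d * x) q n) / Den n     ≈⟨ *-assoc _ _ _ ⟩
        Eₙ * R n                                ∎
        where
        Den : ℕ → Carrier
        Den m = poch (c * x) q (suc m) * poch (d * x) q (suc m)
        cleared : (Dₙ * poch (c * d * x) q N) * Den n ≈ (Eₙ * poch (c * d * x) q n) * Den N
        cleared = solve 6 (λ u v e p a b → u :* v :* (p :* e) :* (a :* b) := e :* p :* (a :* u :* (b :* v))) refl
          (1# - c * x * q ^ N) (1# - d * x * q ^ N) Eₙ (poch (c * d * x) q n) (poch (c * x) q N) (poch (d * x) q N)

      S≈R-suc : S n ≈ R n → S N ≈ R N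
      S≈R-suc S≈R = *-cancelˡ Dₙ≉0 (trans S-recurrence (trans (*-congˡ S≈R) (sym R-recurrence)))
        where
        Dₙ≉0 : Nonzero Dₙ
        Dₙ≉0 = *-nonzero (nonzero-*ʳ cx≉0) (nonzero-*ʳ dx≉0)

    S≈R : ∀ n → Regular n → S n ≈ R n
    S≈R zero    reg = S≈R-zero reg
    S≈R (suc n) reg = Step.S≈R-suc n reg (S≈R n (Regular-pred reg))

mainTheorem3 : ∀ {ℓc ℓ} (F : Field ℓc ℓ) →
  let open Field F
      open FieldDefs F
  in
  (q c d x : Carrier) (n : ℕ) →
  ¬ (q ≈ 0#) →
  ¬ (poch q q n ≈ 0#) →
  ¬ (poch (c * x) q (suc n) ≈ 0#) →
  ¬ (poch (d * x) q (suc n) ≈ 0#) →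
  (∀ k → k ≤ n → ¬ (poch (x * q ^ (suc k)) q (suc n) ≈ 0#)) →
  sumTo n (λ k →
      (- 1#) ^ k * x ^ k * q ^ ((k *ℕ (3 *ℕ k +ℕ 1)) /ℕ 2) * qbin q n k
      * ((poch (c * (q ⁻¹) ^ k) q k * poch (d * (q ⁻¹) ^ k) q k
            * (1# - x * q ^ (2 *ℕ k +ℕ 1)))
         / (poch (c * x) q (suc k) * poch (d * x) q (suc k)
            * poch (x * q ^ (suc k)) q (suc n))))
    ≈ poch (c * d * x) q n / (poch (c * x) q (suc n) * poch (d * x) q (suc n))
mainTheorem3 F q c d x n q≉0 qq≉0 cx≉0 dx≉0 xq≉0 =
  Summation.S≈R F q c d x q≉0 n (record { qq≉0 = qq≉0 ; cx≉0 = cx≉0 ; dx≉0 = dx≉0 ; xq≉0 = xq≉0 })
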